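{- Let $G_1,G_2$ be graphs, let $g_k\in V(G_1)$ be a dominating vertex of $G_1$, and let $\psi\in\mathrm{Aut}(G_2)$. Define $\lambda:V(G_1*G_2)\to V(G_1*G_2)$ by $\lambda(g_k,b)=(g_k,\psi(b))$ for all $b\in V(G_2)$, and $\lambda(a,b)=(a,b)$ for all $a\in V(G_1)\setminus\{g_k\}$, $b\in V(G_2)$. Then $\lambda$ is an automorphism of $G_1*G_2$.
   Context: All graphs are finite and simple. For graphs $G_1,G_2$, the co-normal product $G_1*G_2$ is the graph with vertex set $V(G_1)\times V(G_2)$ in which $(a,b)$ and $(c,d)$ are adjacent if and only if $a$ is adjacent to $c$ in $G_1$ or $b$ is adjacent to $d$ in $G_2$. A dominating vertex of $G$ is a vertex of degree $|V(G)|-1$. -}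

module Defs where

open import Data.Nat using (ℕ)
open import Data.Fin using (Fin)
open import Data.Product using (_×_; _,_; Σ)
open import Data.Sum using (_⊎_)
open import Relation.Nullary using (¬_; Dec)
open import Relation.Binary.PropositionalEquality using (_≡_)
open import Function.Bundles using (_↔_)
open import Function.Base using (_∘_)

record Graph : Set₁ where
  field
    n      : ℕ
    Adj    : Fin n → Fin n → Set
    adj?   : ∀ u v → Dec (Adj u v)
    sym    : ∀ {u v} → Adj u v → Adj v u
    irrefl : ∀ {u} → ¬ Adj u u
open Graph public

V : Graph → Set
V G = Fin (n G)

-- A general "adjacency structure" on an arbitrary vertex type, used to speak
-- about automorphisms of the co-normal product, whose vertex set is V G₁ × V G₂.
IsAutOn : {A : Set} → (A → A → Set) → (A → A) → Set
IsAutOn {A} R f =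
  Σ (A → A) (λ g → (∀ x → g (f x) ≡ x) × (∀ y → f (g y) ≡ y))
  × (∀ x y → (R x y → R (f x) (f y)) × (R (f x) (f y) → R x y))

IsAut : (G : Graph) → (V G → V G) → Set
IsAut G f = IsAutOn (Adj G) f

IsDominating : (G : Graph) → V G → Set
IsDominating G v = ∀ u → ¬ (u ≡ v) → Adj G v u

CoNormalAdj : (G₁ G₂ : Graph) → V G₁ × V G₂ → V G₁ × V G₂ → Set
CoNormalAdj G₁ G₂ (a , b) (c , d) = Adj G₁ a c ⊎ Adj G₂ b d

open import Data.Fin using (_≟_)
open import Relation.Nullary using (yes; no)

liftAt : (G₁ G₂ : Graph) → V G₁ → (V G₂ → V G₂) → V G₁ × V G₂ → V G₁ × V G₂
liftAt G₁ G₂ gk ψ (a , b) with a ≟ gk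
... | yes _ = a , ψ b
... | no  _ = a , b

-- Structure of the proof.
--   * A general criterion: two mutually inverse maps that both preserve a
--     relation R are automorphisms of R; and the inverse of an automorphism
--     preserves the relation as well.
--   * Lifting is functorial: lifting φ after lifting ψ is lifting φ ∘ ψ, and
--     lifting a map that is pointwise the identity is the identity.  Hence the
--     lift of the inverse of ψ is the inverse of the lift of ψ.
--   * Lifting preserves co-normal adjacency whenever the lifted map preserves
--     adjacency of G₂: inside the fibre of gk only the G₂-coordinate can be
--     adjacent (G₁ is loopless), between the fibre and the rest adjacency
--     holds because gk dominates G₁, and off the fibre nothing changes.
module Submission where

open import Defs
open import Data.Fin using (_≟_)
open import Data.Product using (_×_; _,_; proj₁; proj₂)
open import Data.Sum using (inj₁; inj₂)
open import Data.Empty using (⊥-elim)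
open import Function.Base using (_∘_)
open import Relation.Nullary using (yes; no; ¬_)
open import Relation.Binary.PropositionalEquality
  using (_≡_; refl; cong; subst₂; module ≡-Reasoning)
import Relation.Binary.PropositionalEquality as ≡

Preserves : {A : Set} → (A → A → Set) → (A → A) → Set
Preserves R f = ∀ {x y} → R x y → R (f x) (f y)

-- Two mutually inverse maps that both preserve R are automorphisms of R:
-- R reflects along f because applying g to R (f x) (f y) returns R x y.
aut-from-inverse-homs : {A : Set} (R : A → A → Set) (f g : A → A) →
  (∀ x → g (f x) ≡ x) → (∀ y → f (g y) ≡ y) →
  Preserves R f → Preserves R g → IsAutOn R f
aut-from-inverse-homs R f g gf fg f-hom g-hom =
  (g , gf , fg) , λ x y → f-hom , λ r → subst₂ R (gf x) (gf y) (g-hom r)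

inverse-preserves : {A : Set} (R : A → A → Set) (f g : A → A) →
  (∀ y → f (g y) ≡ y) → (∀ x y → R (f x) (f y) → R x y) → Preserves R g
inverse-preserves R f g fg f-reflects {x} {y} r =
  f-reflects (g x) (g y) (subst₂ R (≡.sym (fg x)) (≡.sym (fg y)) r)

module Lifting (G₁ G₂ : Graph) (gk : V G₁) where

  lift : (V G₂ → V G₂) → V G₁ × V G₂ → V G₁ × V G₂
  lift = liftAt G₁ G₂ gk

  lift-on-fibre : ∀ f {a} b → a ≡ gk → lift f (a , b) ≡ (a , f b)
  lift-on-fibre f {a} b a≡gk with a ≟ gk
  ... | yes _    = refl
  ... | no a≢gk  = ⊥-elim (a≢gk a≡gk)

  lift-off-fibre : ∀ f {a} b → ¬ a ≡ gk → lift f (a , b) ≡ (a , b)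
  lift-off-fibre f {a} b a≢gk with a ≟ gk
  ... | yes a≡gk = ⊥-elim (a≢gk a≡gk)
  ... | no _     = refl

  lift-∘ : ∀ φ ψ x → lift φ (lift ψ x) ≡ lift (φ ∘ ψ) x
  lift-∘ φ ψ (a , b) with a ≟ gk
  ... | yes a≡gk = lift-on-fibre φ (ψ b) a≡gk
  ... | no a≢gk  = lift-off-fibre φ b a≢gk

  lift-id : ∀ f → (∀ b → f b ≡ b) → ∀ x → lift f x ≡ x
  lift-id f f≗id (a , b) with a ≟ gk
  ... | yes _ = cong (a ,_) (f≗id b)
  ... | no _  = refl

  lift-inverse : ∀ φ ψ → (∀ b → φ (ψ b) ≡ b) → ∀ x → lift φ (lift ψ x) ≡ x
  lift-inverse φ ψ φψ≗id x = begin
    lift φ (lift ψ x)  ≡⟨ lift-∘ φ ψ x ⟩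
    lift (φ ∘ ψ) x     ≡⟨ lift-id (φ ∘ ψ) φψ≗id x ⟩
    x                  ∎
    where open ≡-Reasoning

  lift-preserves : IsDominating G₁ gk → ∀ f → Preserves (Adj G₂) f →
    Preserves (CoNormalAdj G₁ G₂) (lift f)
  lift-preserves dom f f-hom {a , b} {c , d} r with a ≟ gk | c ≟ gk
  ... | yes refl | yes refl = fibre r
    where
    fibre : CoNormalAdj G₁ G₂ (gk , b) (gk , d) → CoNormalAdj G₁ G₂ (gk , f b) (gk , f d)
    fibre (inj₁ gk~gk) = ⊥-elim (irrefl G₁ gk~gk)
    fibre (inj₂ b~d)   = inj₂ (f-hom b~d)
  ... | yes refl | no c≢gk  = inj₁ (dom c c≢gk)
  ... | no a≢gk  | yes refl = inj₁ (Graph.sym G₁ (dom a a≢gk))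
  ... | no _     | no _     = r

proposition2p9 : (G₁ G₂ : Graph) (gk : V G₁) → IsDominating G₁ gk →
    (ψ : V G₂ → V G₂) → IsAut G₂ ψ →
    IsAutOn (CoNormalAdj G₁ G₂) (liftAt G₁ G₂ gk ψ)
proposition2p9 G₁ G₂ gk dom ψ ((φ , φψ≗id , ψφ≗id) , ψ-adj) =
  aut-from-inverse-homs (CoNormalAdj G₁ G₂) (lift ψ) (lift φ)
    (lift-inverse φ ψ φψ≗id) (lift-inverse ψ φ ψφ≗id)
    (lift-preserves dom ψ (λ {b} {d} → proj₁ (ψ-adj b d)))
    (lift-preserves dom φ (inverse-preserves (Adj G₂) ψ φ ψφ≗id (λ b d → proj₂ (ψ-adj b d))))
  where open Lifting G₁ G₂ gk
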